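{- For any integers $k \geq 2$, $n \geq 0$, and $\alpha,\beta \geq 0$, excluding the case where both $n=0$ and $\alpha=\beta$, $$C^k_{n,(\alpha,\beta)} = C^k_{n,(\alpha+1,\beta)} + C^k_{n-1,(\alpha-k+1,\beta)}.$$
   Context: For an integer $k\ge 2$ and integers $\alpha,\beta, n\ge 0$, let $C^k_{n,(\alpha,\beta)}$ be the number of integer lattice paths from $(0,\alpha)$ to $(kn+\beta-\alpha,\beta)$ using steps $U=(1,1)$ and $D=(1,1-k)$ that stay weakly above the line $y=0$ (such paths have exactly $n$ steps $D$; the empty path counts when $n=0$, $\alpha=\beta$; the count is $0$ when $kn+\beta-\alpha<0$). Convention: $C^k_{n,(\alpha,\beta)}=0$ whenever $\alpha<0$, $\beta<0$, or $n<0$. -}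

module Defs where

open import Data.Nat using (ℕ; zero; suc)
open import Data.Integer using (ℤ; +_; _+_; _-_; _*_; _≤?_; _≟_)
open import Data.Bool using (Bool; true; false; _∧_; if_then_else_)
open import Data.List using (List; []; _∷_; filter; length; map; _++_)
open import Relation.Nullary.Decidable using (⌊_⌋; _because_)
open import Relation.Nullary using (yes; no)

-- Steps of a lattice path: U = (1,1), D = (1, 1-k).
data Step : Set where
  U D : Step

allSeqs : ℕ → List (List Step)
allSeqs zero    = [] ∷ []
allSeqs (suc m) = map (U ∷_) (allSeqs m) ++ map (D ∷_) (allSeqs m)

δ : ℕ → Step → ℤ
δ k U = + 1
δ k D = + 1 - + k

staysAbove : ℕ → ℤ → List Step → Bool
staysAbove k h []      = ⌊ + 0 ≤? h ⌋
staysAbove k h (s ∷ p) = ⌊ + 0 ≤? h ⌋ ∧ staysAbove k (h + δ k s) p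

endHeight : ℕ → ℤ → List Step → ℤ
endHeight k h []      = h
endHeight k h (s ∷ p) = endHeight k (h + δ k s) p

numD : List Step → ℕ
numD []      = 0
numD (U ∷ p) = numD p
numD (D ∷ p) = suc (numD p)

-- A path from (0,α) to (k n + β - α, β) with exactly n D-steps staying weakly above y = 0.
validPath : ℕ → ℕ → ℤ → ℤ → List Step → Bool
validPath k n α β p =
  staysAbove k α p ∧ ⌊ endHeight k α p ≟ β ⌋ ∧ ⌊ numD p Data.Nat.≟ n ⌋

-- C^k_{n,(α,β)}, with arguments in ℤ; 0 if α < 0, β < 0, n < 0, or k n + β - α < 0.
C : ℕ → ℤ → ℤ → ℤ → ℕ
C k (+ n) (+ a) (+ b) with + k * + n + + b - + a
... | + L = length (filter (λ p → validPath k n (+ a) (+ b) p Data.Bool.≟ true) (allSeqs L))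
... | _   = 0
C k _ _ _ = 0

-- Sort the sequences of a given length by their first step.  A path whose first
-- step is U is a valid path from height α + 1 of one step less; a path whose
-- first step is D is a valid path from height α − k + 1 with one D step less.
-- The two lengths agree with the ones the definition of C assigns to the
-- right-hand side, and the only path missed by the decomposition is the empty
-- one, which is valid exactly when n = 0 and α = β.
module Submission where

open import Defs
open import Data.Nat as ℕ using (ℕ; zero; suc; _≤_; _+_)
open import Data.Nat.Properties using (suc-injective)
open import Data.Integer as ℤ using (ℤ; +_; -[1+_]; _-_) renaming (_+_ to _+ℤ_)
open import Data.Integer.Properties using (+-injective)
open import Data.Integer.Tactic.RingSolver using (solve-∀)
open import Data.Bool as Bool using (Bool; true; false; _∧_)
open import Data.Bool.Properties using (not-¬; ∧-zeroʳ)
open import Data.List using (List; []; _∷_; filter; length; map; _++_)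
open import Data.List.Properties using (length-++; filter-++; filter-≐; filter-none)
open import Data.List.Relation.Unary.All using (universal)
open import Data.Product using (_×_; _,_)
open import Function using (_∘_)
open import Relation.Binary.PropositionalEquality
  using (_≡_; refl; sym; trans; cong; cong₂; module ≡-Reasoning)
open import Relation.Nullary using (¬_; yes; no; contradiction)
open import Relation.Nullary.Decidable using (⌊_⌋)

count : (List Step → Bool) → List (List Step) → ℕ
count f xs = length (filter (λ p → f p Bool.≟ true) xs)

count-++ : ∀ f xs ys → count f (xs ++ ys) ≡ count f xs + count f ys
count-++ f xs ys = trans (cong length (filter-++ _ xs ys)) (length-++ (filter _ xs))

count-map : ∀ f (g : List Step → List Step) xs → count f (map g xs) ≡ count (f ∘ g) xs
count-map f g []       = refl
count-map f g (x ∷ xs) with f (g x)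
... | true  = cong suc (count-map f g xs)
... | false = count-map f g xs

count-cong : ∀ {f g} → (∀ p → f p ≡ g p) → ∀ xs → count f xs ≡ count g xs
count-cong f≗g xs =
  cong length (filter-≐ _ _ (trans (sym (f≗g _)) , trans (f≗g _)) xs)

count-none : ∀ {f} → (∀ p → f p ≡ false) → ∀ xs → count f xs ≡ 0
count-none f≡false xs = cong length (filter-none _ (universal (λ p → not-¬ (f≡false p)) xs))

countOfLength : (List Step → Bool) → ℤ → ℕ
countOfLength f (+ L)    = count f (allSeqs L)
countOfLength f -[1+ _ ] = 0

countOfLength-cong : ∀ {f g} → (∀ p → f p ≡ g p) → ∀ L → countOfLength f L ≡ countOfLength g L
countOfLength-cong f≗g (+ L)    = count-cong f≗g (allSeqs L)
countOfLength-cong f≗g -[1+ _ ] = refl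

countOfLength-none : ∀ {f} → (∀ p → f p ≡ false) → ∀ L → countOfLength f L ≡ 0
countOfLength-none f≡false (+ L)    = count-none f≡false (allSeqs L)
countOfLength-none f≡false -[1+ _ ] = refl

countOfLength-suc : ∀ f L →
  countOfLength f (+ suc L) ≡ countOfLength (f ∘ (U ∷_)) (+ L) + countOfLength (f ∘ (D ∷_)) (+ L)
countOfLength-suc f L = begin
  count f (map (U ∷_) (allSeqs L) ++ map (D ∷_) (allSeqs L))
    ≡⟨ count-++ f (map (U ∷_) (allSeqs L)) (map (D ∷_) (allSeqs L)) ⟩
  count f (map (U ∷_) (allSeqs L)) + count f (map (D ∷_) (allSeqs L))
    ≡⟨ cong₂ _+_ (count-map f (U ∷_) (allSeqs L)) (count-map f (D ∷_) (allSeqs L)) ⟩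
  count (f ∘ (U ∷_)) (allSeqs L) + count (f ∘ (D ∷_)) (allSeqs L) ∎
  where open ≡-Reasoning

countOfLength-firstStep : ∀ {f} → f [] ≡ false → ∀ L →
  countOfLength f L ≡ countOfLength (f ∘ (U ∷_)) (L - + 1) + countOfLength (f ∘ (D ∷_)) (L - + 1)
countOfLength-firstStep f[]≡false (+ zero) rewrite f[]≡false = refl
countOfLength-firstStep {f} _ (+ suc L) = countOfLength-suc f L
countOfLength-firstStep     _ -[1+ _ ]  = refl

validPath-negative-start : ∀ k n x b p → validPath k n -[1+ x ] b p ≡ false
validPath-negative-start k n x b []      = refl
validPath-negative-start k n x b (_ ∷ _) = refl

≟-suc : ∀ x m → ⌊ suc x ℕ.≟ suc m ⌋ ≡ ⌊ x ℕ.≟ m ⌋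
≟-suc x m with x ℕ.≟ m | suc x ℕ.≟ suc m
... | yes _   | yes _     = refl
... | no _    | no _      = refl
... | yes x≡m | no sx≢sm  = contradiction (cong suc x≡m) sx≢sm
... | no x≢m  | yes sx≡sm = contradiction (suc-injective sx≡sm) x≢m

validPath-D : ∀ k m α b p → validPath k (suc m) (+ α) b (D ∷ p) ≡ validPath k m (+ α +ℤ δ k D) b p
validPath-D k m α b p =
  cong (λ t → staysAbove k a p ∧ ⌊ endHeight k a p ℤ.≟ b ⌋ ∧ t) (≟-suc (numD p) m)
  where a = + α +ℤ δ k D

validPath-D-zero : ∀ k a b p → validPath k 0 a b (D ∷ p) ≡ false
validPath-D-zero k a b p =
  trans (cong (staysAbove k a (D ∷ p) ∧_) (∧-zeroʳ _)) (∧-zeroʳ (staysAbove k a (D ∷ p)))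

emptyPath-invalid : ∀ k n α β → ¬ (n ≡ 0 × α ≡ β) → validPath k n (+ α) (+ β) [] ≡ false
emptyPath-invalid k n α β not-empty with + α ℤ.≟ + β | 0 ℕ.≟ n
... | yes α≡β | yes 0≡n = contradiction (sym 0≡n , +-injective α≡β) not-empty
... | yes _   | no _    = refl
... | no _    | _       = refl

C≡countOfLength : ∀ k n a b →
  C k (+ n) a (+ b) ≡ countOfLength (validPath k n a (+ b)) (+ k ℤ.* + n +ℤ + b - a)
C≡countOfLength k n (+ a) b with + k ℤ.* + n +ℤ + b - + a
... | + L      = refl
... | -[1+ _ ] = refl
C≡countOfLength k n -[1+ a ] b =
  sym (countOfLength-none (validPath-negative-start k n a (+ b)) (+ k ℤ.* + n +ℤ + b - -[1+ a ]))

C-firstStepU : ∀ k n α β →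
  C k (+ n) (+ (α + 1)) (+ β)
    ≡ countOfLength (validPath k n (+ α) (+ β) ∘ (U ∷_)) (+ k ℤ.* + n +ℤ + β - + α - + 1)
C-firstStepU k n α β =
  trans (C≡countOfLength k n (+ (α + 1)) β)
        (cong (countOfLength (validPath k n (+ (α + 1)) (+ β))) (shift (+ k) (+ n) (+ β) (+ α)))
  where
  shift : ∀ (K N B A : ℤ) → K ℤ.* N +ℤ B - (A +ℤ + 1) ≡ K ℤ.* N +ℤ B - A - + 1
  shift = solve-∀

C-firstStepD : ∀ k n α β →
  C k (+ n - + 1) (+ α - + k +ℤ + 1) (+ β)
    ≡ countOfLength (validPath k n (+ α) (+ β) ∘ (D ∷_)) (+ k ℤ.* + n +ℤ + β - + α - + 1)
C-firstStepD k zero    α β =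
  sym (countOfLength-none (validPath-D-zero k (+ α) (+ β)) (+ k ℤ.* + 0 +ℤ + β - + α - + 1))
C-firstStepD k (suc m) α β = begin
  C k (+ m) (+ α - + k +ℤ + 1) (+ β)
    ≡⟨ C≡countOfLength k m (+ α - + k +ℤ + 1) β ⟩
  countOfLength (validPath k m (+ α - + k +ℤ + 1) (+ β)) (+ k ℤ.* + m +ℤ + β - (+ α - + k +ℤ + 1))
    ≡⟨ cong₂ (λ a → countOfLength (validPath k m a (+ β)))
             (sym (afterD (+ α) (+ k))) (shift (+ k) (+ m) (+ β) (+ α)) ⟩
  countOfLength (validPath k m (+ α +ℤ δ k D) (+ β)) (+ k ℤ.* + suc m +ℤ + β - + α - + 1)
    ≡⟨ sym (countOfLength-cong (validPath-D k m α (+ β)) (+ k ℤ.* + suc m +ℤ + β - + α - + 1)) ⟩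
  countOfLength (validPath k (suc m) (+ α) (+ β) ∘ (D ∷_)) (+ k ℤ.* + suc m +ℤ + β - + α - + 1) ∎
  where
  open ≡-Reasoning
  afterD : ∀ (A K : ℤ) → A +ℤ (+ 1 - K) ≡ A - K +ℤ + 1
  afterD = solve-∀
  shift : ∀ (K M B A : ℤ) → K ℤ.* M +ℤ B - (A - K +ℤ + 1) ≡ K ℤ.* (+ 1 +ℤ M) +ℤ B - A - + 1
  shift = solve-∀

-- The recurrence holds for every k.
proposition2p1 : (k n α β : ℕ) → 2 ≤ k → ¬ (n ≡ 0 × α ≡ β) →
    C k (+ n) (+ α) (+ β)
      ≡ C k (+ n) (+ (α + 1)) (+ β) + C k (+ n - + 1) (+ α - + k +ℤ + 1) (+ β)
proposition2p1 k n α β _ not-empty = begin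
  C k (+ n) (+ α) (+ β)
    ≡⟨ C≡countOfLength k n (+ α) β ⟩
  countOfLength paths L
    ≡⟨ countOfLength-firstStep (emptyPath-invalid k n α β not-empty) L ⟩
  countOfLength (paths ∘ (U ∷_)) (L - + 1) + countOfLength (paths ∘ (D ∷_)) (L - + 1)
    ≡⟨ sym (cong₂ _+_ (C-firstStepU k n α β) (C-firstStepD k n α β)) ⟩
  C k (+ n) (+ (α + 1)) (+ β) + C k (+ n - + 1) (+ α - + k +ℤ + 1) (+ β) ∎
  where
  open ≡-Reasoning
  paths : List Step → Bool
  paths = validPath k n (+ α) (+ β)
  L : ℤ
  L = + k ℤ.* + n +ℤ + β - + α
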